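{- The quasi-order $\big(D_\omega(\mathbf{\Sigma}^0_1)(\mathcal{P}\omega),\leq_w\big)$ is ill-founded; that is, there exists a sequence $(\mathcal{A}_n)_{n\in\omega}$ of sets in $D_\omega(\mathbf{\Sigma}^0_1)(\mathcal{P}\omega)$ such that $\mathcal{A}_{n+1}<_w\mathcal{A}_n$ for every $n\in\omega$.
   Context: The Scott domain $\mathcal{P}\omega$ is the power set of $\omega$ with the topology generated by the basic open sets $\mathcal{O}_F=\{x\subseteq\omega\mid F\subseteq x\}$ for finite $F\subseteq\omega$. For a sequence $(A_\beta)_{\beta<\alpha}$ of subsets of a space, $D_\alpha\big((A_\beta)_{\beta<\alpha}\big)=\bigcup\{A_\beta\setminus\bigcup_{\gamma<\beta}A_\gamma \mid \beta<\alpha,\ \alpha \text{ and } \beta \text{ have different parities}\}$ (limit ordinals are even); $D_\omega(\mathbf{\Sigma}^0_1)(\mathcal{P}\omega)$ is the class of all sets $D_\omega\big((A_n)_{n<\omega}\big)$ with every $A_n$ open in $\mathcal{P}\omega$. For $\mathcal{A},\mathcal{B}\subseteq\mathcal{P}\omega$, $\mathcal{A}\leq_w\mathcal{B}$ (Wadge reducibility) means there is a continuous $f:\mathcal{P}\omega\to\mathcal{P}\omega$ with $f^{ -1}[\mathcal{B}]=\mathcal{A}$; $\mathcal{A}<_w\mathcal{B}$ means $\mathcal{A}\leq_w\mathcal{B}$ and $\mathcal{B}\not\leq_w\mathcal{A}$. -}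

module Defs where

open import Data.Nat using (ℕ; suc; _+_; _<_)
open import Data.Bool using (Bool; true)
open import Data.List using (List)
open import Data.List.Relation.Unary.All using (All)
open import Data.Product using (Σ; _×_; ∃)
open import Relation.Binary.PropositionalEquality using (_≡_)
open import Relation.Nullary using (¬_)
open import Function.Bundles using (_⇔_)

Pω : Set
Pω = ℕ → Bool

SubPω : Set₁
SubPω = Pω → Set

_⊆ᶠ_ : List ℕ → Pω → Set
F ⊆ᶠ x = All (λ n → x n ≡ true) F

-- Scott-open: a union of basic open sets O_F = { x | F ⊆ x }, F finite.
IsOpen : SubPω → Set₁
IsOpen U = Σ (List ℕ → Set) λ 𝓕 → ∀ x → U x ⇔ (∃ λ F → 𝓕 F × (F ⊆ᶠ x))

Odd : ℕ → Set
Odd β = ∃ λ k → β ≡ suc (k + k)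

-- D_ω((A_n)_n): β < ω of parity different from ω (ω even), i.e. β odd.
Dω : (ℕ → SubPω) → SubPω
Dω A x = ∃ λ β → Odd β × A β x × (∀ γ → γ < β → ¬ A γ x)

InDωΣ01 : SubPω → Set₁
InDωΣ01 B = Σ (ℕ → SubPω) λ A → (∀ n → IsOpen (A n)) × (∀ x → B x ⇔ Dω A x)

Continuous : (Pω → Pω) → Set₁
Continuous f = ∀ (U : SubPω) → IsOpen U → IsOpen (λ x → U (f x))

_≤w_ : SubPω → SubPω → Set₁
A ≤w B = Σ (Pω → Pω) λ f → Continuous f × (∀ x → A x ⇔ B (f x))

_<w_ : SubPω → SubPω → Set₁
A <w B = (A ≤w B) × ¬ (B ≤w A)

module Submission where

-- Code ω as ℕ × ℕ, a point n having a position pos n and a level lev n. The set 𝒜 c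
-- consists of the x whose points lie in the cone c · lev ≤ pos and at two adjacent
-- positions, and whose least level exists and is even; it is D_ω of the open sets
-- "x leaves the cone or meets two non-adjacent positions" and "x has a point of level j".
--
-- 𝒜 (c + 1) ≤w 𝒜 c: add to x, for each of its points outside the steeper cone, the point
-- two positions to its right; this keeps x if x lies in the steeper cone and spoils
-- adjacency otherwise.
--
-- 𝒜 c ≰w 𝒜 (c + 1): a reduction f is monotone. Let column t e be the points at position t
-- of level at least e inside the c-cone. By induction on i, every point of f (column t 2i)
-- has level ≥ 2i: were the least level of f (column t (2i + 2)) still 2i, then
-- f (column t (2i + 1)), squeezed between the images of its even neighbours, would lie in
-- 𝒜 (c + 1) although column t (2i + 1) has odd least level. On the other hand the image of
-- two adjacent columns t, t + 1 meets only adjacent positions, so f (column t 0) stays at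
-- positions ≤ t + s₀ + 1. For i = s₀ + 1 and t = 2ci, a point of f (column t 2i) then lies
-- outside the (c + 1)-cone.

open import Defs
open import Data.Nat using (ℕ; zero; suc; _+_; _*_; _∸_; _≤_; _<_; z≤n; s≤s; z<s; _≤?_; _<?_)
open import Data.Nat.Properties
open import Data.Bool using (true)
import Data.Bool.Properties as Bool
open import Data.List using (List; []; _∷_; _++_; [_])
open import Data.List.Relation.Unary.All using ([]; _∷_)
import Data.List.Relation.Unary.All as All
open import Data.List.Relation.Unary.All.Properties using (++⁺; ++⁻ˡ; ++⁻ʳ)
open import Data.Product using (Σ; _×_; _,_; proj₁; proj₂; ∃)
open import Data.Sum using (_⊎_; inj₁; inj₂)
open import Data.Empty using (⊥)
open import Level using (0ℓ)
open import Relation.Unary using (Pred; Decidable)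
open import Relation.Binary.PropositionalEquality
  using (_≡_; _≢_; refl; sym; trans; cong; cong₂; subst; subst₂; module ≡-Reasoning)
open import Relation.Nullary using (¬_; Dec; yes; no; does; contradiction; _×-dec_; _⊎-dec_)
open import Function using (_∘_)
open import Function.Bundles using (_⇔_; mk⇔; Equivalence)
open import Function.Construct.Identity using (⇔-id)

open Equivalence using (to; from)

-- unpair walks each antidiagonal a + b = s from (0 , s) to (s , 0).

step : ℕ × ℕ → ℕ × ℕ
step (a , zero)  = zero , suc a
step (a , suc b) = suc a , b

unpair : ℕ → ℕ × ℕ
unpair zero    = 0 , 0
unpair (suc n) = step (unpair n)

triangle : ℕ → ℕ
triangle zero    = 0
triangle (suc s) = suc (triangle s + s)

pair : ℕ → ℕ → ℕ
pair a b = triangle (a + b) + a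

pos lev : ℕ → ℕ
pos = proj₁ ∘ unpair
lev = proj₂ ∘ unpair

unpair-triangle+ : ∀ s a b → a + b ≡ s → unpair (triangle s + a) ≡ (a , b)
unpair-triangle+ zero    zero    zero refl = refl
unpair-triangle+ (suc s) zero    _    refl = begin
  unpair (triangle (suc s) + 0)   ≡⟨ cong unpair (+-identityʳ (triangle (suc s))) ⟩
  step (unpair (triangle s + s))  ≡⟨ cong step (unpair-triangle+ s s 0 (+-identityʳ s)) ⟩
  (0 , suc s)                     ∎
  where open ≡-Reasoning
unpair-triangle+ s       (suc a) b    eq = begin
  unpair (triangle s + suc a)     ≡⟨ cong unpair (+-suc (triangle s) a) ⟩
  step (unpair (triangle s + a))  ≡⟨ cong step (unpair-triangle+ s a (suc b) (trans (+-suc a b) eq)) ⟩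
  (suc a , b)                     ∎
  where open ≡-Reasoning

unpair-pair : ∀ a b → unpair (pair a b) ≡ (a , b)
unpair-pair a b = unpair-triangle+ (a + b) a b refl

pos-pair : ∀ a b → pos (pair a b) ≡ a
pos-pair a b = cong proj₁ (unpair-pair a b)

lev-pair : ∀ a b → lev (pair a b) ≡ b
lev-pair a b = cong proj₂ (unpair-pair a b)

pair-step : ∀ a b → pair (proj₁ (step (a , b))) (proj₂ (step (a , b))) ≡ suc (pair a b)
pair-step a zero    rewrite +-identityʳ a | +-identityʳ (suc (triangle a + a)) = refl
pair-step a (suc b) rewrite +-suc a b | +-suc (triangle (suc (a + b))) a = refl

pair-pos-lev : ∀ n → pair (pos n) (lev n) ≡ n
pair-pos-lev zero    = refl
pair-pos-lev (suc n) = trans (pair-step (pos n) (lev n)) (cong suc (pair-pos-lev n))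

infix 4 _∈_ _∈?_ _⊆_

_∈_ : ℕ → Pω → Set
n ∈ x = x n ≡ true

_∈?_ : ∀ n x → Dec (n ∈ x)
n ∈? x = x n Bool.≟ true

_⊆_ : Pω → Pω → Set
x ⊆ y = ∀ {n} → n ∈ x → n ∈ y

fromDec : {P : Pred ℕ 0ℓ} → Decidable P → Pω
fromDec P? n = does (P? n)

∈-fromDec : ∀ {P : Pred ℕ 0ℓ} (P? : Decidable P) {n} → n ∈ fromDec P? ⇔ P n
∈-fromDec P? {n} with P? n
... | yes p = mk⇔ (λ _ → p) (λ _ → refl)
... | no ¬p = mk⇔ (λ ()) (λ p → contradiction p ¬p)

∈-isOpen : ∀ n → IsOpen (n ∈_)
∈-isOpen n = (_≡ [ n ]) , λ z → mk⇔ (λ n∈z → [ n ] , refl , n∈z ∷ []) λ { (_ , refl , n∈z ∷ []) → n∈z }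

continuous⇒monotone : ∀ {f} → Continuous f → ∀ {x y} → x ⊆ y → f x ⊆ f y
continuous⇒monotone {f} f-cont {x} {y} x⊆y {n} n∈fx
  with f-cont (n ∈_) (∈-isOpen n)
... | _ , open-iff with to (open-iff x) n∈fx
... | F , F∈𝓕 , F⊆x = from (open-iff y) (F , F∈𝓕 , All.map x⊆y F⊆x)

Finitary : (Pω → Pω) → Set
Finitary f = ∀ x n → n ∈ f x → Σ (List ℕ) λ G → G ⊆ᶠ x × (∀ y → G ⊆ᶠ y → n ∈ f y)

finitary⇒continuous : ∀ {f} → Finitary f → Continuous f
finitary⇒continuous {f} f-fin U (𝓕 , U-iff) = 𝓕′ , λ x → mk⇔ (forth x) (back x)
  where
  𝓕′ : List ℕ → Set
  𝓕′ G = Σ (List ℕ) λ F → 𝓕 F × (∀ y → G ⊆ᶠ y → F ⊆ᶠ f y)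

  support : ∀ x F → F ⊆ᶠ f x → Σ (List ℕ) λ G → G ⊆ᶠ x × (∀ y → G ⊆ᶠ y → F ⊆ᶠ f y)
  support x []      []            = [] , [] , λ _ _ → []
  support x (n ∷ F) (n∈fx ∷ F⊆fx) with f-fin x n n∈fx | support x F F⊆fx
  ... | G₁ , G₁⊆x , G₁-forces | G₂ , G₂⊆x , G₂-forces =
    G₁ ++ G₂ , ++⁺ G₁⊆x G₂⊆x ,
    λ y G⊆y → G₁-forces y (++⁻ˡ G₁ G⊆y) ∷ G₂-forces y (++⁻ʳ G₁ G⊆y)

  forth : ∀ x → U (f x) → ∃ λ G → 𝓕′ G × G ⊆ᶠ x
  forth x u with to (U-iff (f x)) u
  ... | F , F∈𝓕 , F⊆fx with support x F F⊆fx
  ... | G , G⊆x , G-forces = G , (F , F∈𝓕 , G-forces) , G⊆x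

  back : ∀ x → (∃ λ G → 𝓕′ G × G ⊆ᶠ x) → U (f x)
  back x (G , (F , F∈𝓕 , G-forces) , G⊆x) = from (U-iff (f x)) (F , F∈𝓕 , G-forces x G⊆x)

double≢odd : ∀ h i → h + h ≢ suc (i + i)
double≢odd zero    i       ()
double≢odd (suc h) zero    eq rewrite +-suc h h = 0≢1+n (sym (suc-injective eq))
double≢odd (suc h) (suc i) eq rewrite +-suc h h | +-suc i i = double≢odd h i (suc-injective (suc-injective eq))

double-gap : ∀ {i k} → i + i ≤ k + k → k + k ≡ i + i ⊎ suc i + suc i ≤ k + k
double-gap {i} {k} le with m≤n⇒m<n∨m≡n le
... | inj₂ eq = inj₁ (sym eq)
... | inj₁ lt with m≤n⇒m<n∨m≡n lt
...   | inj₁ lt′ = inj₂ (subst (_≤ k + k) (cong suc (sym (+-suc i i))) lt′)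
...   | inj₂ eq  = contradiction (sym eq) (double≢odd k i)

basis : ℕ → ℕ → List ℕ → Set
basis c zero    F = (∃ λ n → F ≡ [ n ] × pos n < c * lev n)
                  ⊎ (∃ λ m → ∃ λ n → F ≡ m ∷ n ∷ [] × suc (pos m) < pos n)
basis c (suc j) F = ∃ λ n → F ≡ [ n ] × lev n ≡ j

layer : ℕ → ℕ → SubPω
layer c j x = ∃ λ F → basis c j F × F ⊆ᶠ x

𝒜 : ℕ → SubPω
𝒜 c = Dω (layer c)

𝒜∈DωΣ01 : ∀ c → InDωΣ01 (𝒜 c)
𝒜∈DωΣ01 c = layer c , (λ j → basis c j , λ x → ⇔-id (layer c j x)) , λ x → ⇔-id (𝒜 c x)

record Tame (c : ℕ) (x : Pω) : Set where
  field
    cone         : ∀ {n} → n ∈ x → c * lev n ≤ pos n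
    narrow       : ∀ {m n} → m ∈ x → n ∈ x → pos n ≤ suc (pos m)
    half         : ℕ
    bottom       : ℕ
    bottom∈      : bottom ∈ x
    lev-bottom   : lev bottom ≡ half + half
    bottom-least : ∀ {n} → n ∈ x → half + half ≤ lev n

open Tame

𝒜⇒Tame : ∀ {c x} → 𝒜 c x → Tame c x
𝒜⇒Tame {c} {x} (_ , (k , refl) , (_ , (w , refl , lev-w) , w∈x ∷ []) , below) = record
  { cone = cone′ ; narrow = narrow′ ; half = k ; bottom = w ; bottom∈ = w∈x
  ; lev-bottom = lev-w ; bottom-least = bottom-least′ }
  where
  cone′ : ∀ {n} → n ∈ x → c * lev n ≤ pos n
  cone′ {n} n∈x with c * lev n ≤? pos n
  ... | yes le = le
  ... | no ≰ = contradiction ([ n ] , inj₁ (n , refl , ≰⇒> ≰) , n∈x ∷ []) (below 0 z<s)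
  narrow′ : ∀ {m n} → m ∈ x → n ∈ x → pos n ≤ suc (pos m)
  narrow′ {m} {n} m∈x n∈x with pos n ≤? suc (pos m)
  ... | yes le = le
  ... | no ≰ = contradiction (m ∷ n ∷ [] , inj₂ (m , n , refl , ≰⇒> ≰) , m∈x ∷ n∈x ∷ []) (below 0 z<s)
  bottom-least′ : ∀ {n} → n ∈ x → k + k ≤ lev n
  bottom-least′ {n} n∈x with k + k ≤? lev n
  ... | yes le = le
  ... | no ≰ = contradiction ([ n ] , (n , refl , refl) , n∈x ∷ []) (below (suc (lev n)) (s≤s (≰⇒> ≰)))

Tame⇒𝒜 : ∀ {c x} → Tame c x → 𝒜 c x
Tame⇒𝒜 {c} {x} t =
  suc (half t + half t) , (half t , refl) , ([ bottom t ] , (bottom t , refl , lev-bottom t) , bottom∈ t ∷ []) , below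
  where
  below : ∀ γ → γ < suc (half t + half t) → ¬ layer c γ x
  below zero    _       (_ , inj₁ (n , refl , lt) , n∈x ∷ [])             = <⇒≱ lt (cone t n∈x)
  below zero    _       (_ , inj₂ (m , n , refl , lt) , m∈x ∷ n∈x ∷ []) = <⇒≱ lt (narrow t m∈x n∈x)
  below (suc j) (s≤s lt) (_ , (n , refl , refl) , n∈x ∷ [])              = <⇒≱ lt (bottom-least t n∈x)

Tame-⊆ : ∀ {c x y} → x ⊆ y → Tame c y → ∀ {b h} → b ∈ x → lev b ≡ h + h
       → (∀ {n} → n ∈ y → h + h ≤ lev n) → Tame c x
Tame-⊆ x⊆y t {b} {h} b∈x lev-b least = record
  { cone = cone t ∘ x⊆y ; narrow = λ m∈x n∈x → narrow t (x⊆y m∈x) (x⊆y n∈x)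
  ; half = h ; bottom = b ; bottom∈ = b∈x ; lev-bottom = lev-b ; bottom-least = least ∘ x⊆y }

Tame-cone : ∀ {c d x} → (∀ {n} → n ∈ x → d * lev n ≤ pos n) → Tame c x → Tame d x
Tame-cone d-cone t = record
  { cone = d-cone ; narrow = narrow t ; half = half t ; bottom = bottom t ; bottom∈ = bottom∈ t
  ; lev-bottom = lev-bottom t ; bottom-least = bottom-least t }

m*0≤n : ∀ m n → m * 0 ≤ n
m*0≤n m n = subst (_≤ n) (sym (*-zeroʳ m)) z≤n

InColumn : ℕ → ℕ → ℕ → Pred ℕ 0ℓ
InColumn c t e n = pos n ≡ t × e ≤ lev n × c * lev n ≤ t

inColumn? : ∀ c t e → Decidable (InColumn c t e)
inColumn? c t e n = pos n ≟ t ×-dec e ≤? lev n ×-dec c * lev n ≤? t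

-- Sealed, so that unification recovers c, t and e from a membership proof.
opaque
  column : ℕ → ℕ → ℕ → Pω
  column c t e = fromDec (inColumn? c t e)

  ∈column : ∀ {c t e n} → n ∈ column c t e ⇔ InColumn c t e n
  ∈column {c} {t} {e} {n} = ∈-fromDec (inColumn? c t e) {n}

pair∈column : ∀ {c t e} → c * e ≤ t → pair t e ∈ column c t e
pair∈column {c} {t} {e} le = from ∈column
  (pos-pair t e , ≤-reflexive (sym (lev-pair t e)) , subst (λ l → c * l ≤ t) (sym (lev-pair t e)) le)

column-antitone : ∀ {c t e e′} → e ≤ e′ → column c t e′ ⊆ column c t e
column-antitone e≤e′ n∈ with to ∈column n∈
... | pos-n , e′≤lev , cone-n = from ∈column (pos-n , ≤-trans e≤e′ e′≤lev , cone-n)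

column-tame : ∀ c t i → c * (i + i) ≤ t → Tame c (column c t (i + i))
column-tame c t i le = record
  { cone = λ n∈ → let (pos-n , _ , cone-n) = to ∈column n∈ in subst (c * _ ≤_) (sym pos-n) cone-n
  ; narrow = λ m∈ n∈ → subst₂ (λ p q → q ≤ suc p) (sym (proj₁ (to ∈column m∈))) (sym (proj₁ (to ∈column n∈)))
                              (n≤1+n t)
  ; half = i ; bottom = pair t (i + i) ; bottom∈ = pair∈column le ; lev-bottom = lev-pair t (i + i)
  ; bottom-least = λ n∈ → proj₁ (proj₂ (to ∈column n∈)) }

odd-column-¬tame : ∀ c t i → c * suc (i + i) ≤ t → ¬ Tame c (column c t (suc (i + i)))
odd-column-¬tame c t i le tame = double≢odd (half tame) i (≤-antisym below above)
  where
  below : half tame + half tame ≤ suc (i + i)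
  below = subst (_ ≤_) (lev-pair t _) (bottom-least tame (pair∈column le))
  above : suc (i + i) ≤ half tame + half tame
  above = subst (_ ≤_) (lev-bottom tame) (proj₁ (proj₂ (to ∈column (bottom∈ tame))))

InAdjacent : ℕ → ℕ → Pred ℕ 0ℓ
InAdjacent c t n = (pos n ≡ t ⊎ pos n ≡ suc t) × c * lev n ≤ pos n

inAdjacent? : ∀ c t → Decidable (InAdjacent c t)
inAdjacent? c t n = (pos n ≟ t ⊎-dec pos n ≟ suc t) ×-dec c * lev n ≤? pos n

opaque
  adjacent : ℕ → ℕ → Pω
  adjacent c t = fromDec (inAdjacent? c t)

  ∈adjacent : ∀ {c t n} → n ∈ adjacent c t ⇔ InAdjacent c t n
  ∈adjacent {c} {t} {n} = ∈-fromDec (inAdjacent? c t) {n}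

column⊆adjacent : ∀ {c t s} → (s ≡ t ⊎ s ≡ suc t) → column c s 0 ⊆ adjacent c t
column⊆adjacent s-adj n∈ with to ∈column n∈
... | refl , _ , cone-n = from ∈adjacent (s-adj , cone-n)

adjacent-tame : ∀ c t → Tame c (adjacent c t)
adjacent-tame c t = record
  { cone = λ n∈ → proj₂ (to ∈adjacent n∈)
  ; narrow = λ m∈ n∈ → ≤-trans (at-most (proj₁ (to ∈adjacent n∈))) (s≤s (at-least (proj₁ (to ∈adjacent m∈))))
  ; half = 0 ; bottom = pair t 0 ; bottom∈ = column⊆adjacent (inj₁ refl) (pair∈column (m*0≤n c t))
  ; lev-bottom = lev-pair t 0 ; bottom-least = λ _ → z≤n }
  where
  at-least : ∀ {p} → p ≡ t ⊎ p ≡ suc t → t ≤ p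
  at-least (inj₁ refl) = ≤-refl
  at-least (inj₂ refl) = n≤1+n t
  at-most : ∀ {p} → p ≡ t ⊎ p ≡ suc t → p ≤ suc t
  at-most (inj₁ refl) = n≤1+n t
  at-most (inj₂ refl) = ≤-refl

-- 𝒜 (suc c) reduces to 𝒜 c

module _ (c : ℕ) where

  Steep : Pω → Pred ℕ 0ℓ
  Steep x m = m ∈ x × pos m < suc c * lev m

  steep? : ∀ x → Decidable (Steep x)
  steep? x m = m ∈? x ×-dec pos m <? suc c * lev m

  source : ℕ → ℕ
  source n = pair (pos n ∸ 2) (lev n)

  shift : ℕ → ℕ
  shift m = pair (2 + pos m) (lev m)

  source-shift : ∀ m → source (shift m) ≡ m
  source-shift m = trans (cong₂ pair (cong (_∸ 2) (pos-pair (2 + pos m) (lev m))) (lev-pair (2 + pos m) (lev m)))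
                         (pair-pos-lev m)

  -- The equation on pos n rules out the truncation in pos n ∸ 2.
  InWiden : Pω → Pred ℕ 0ℓ
  InWiden x n = n ∈ x ⊎ Steep x (source n) × pos n ≡ 2 + pos (source n)

  inWiden? : ∀ x → Decidable (InWiden x)
  inWiden? x n = n ∈? x ⊎-dec steep? x (source n) ×-dec pos n ≟ 2 + pos (source n)

  opaque
    widen : Pω → Pω
    widen x = fromDec (inWiden? x)

    ∈widen : ∀ {x n} → n ∈ widen x ⇔ InWiden x n
    ∈widen {x} {n} = ∈-fromDec (inWiden? x) {n}

  widen-finitary : Finitary widen
  widen-finitary x n n∈ with to ∈widen n∈
  ... | inj₁ n∈x = [ n ] , n∈x ∷ [] , λ { y (n∈y ∷ []) → from ∈widen (inj₁ n∈y) }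
  ... | inj₂ ((s∈x , s-steep) , n-shifted) =
    [ source n ] , s∈x ∷ [] , λ { y (s∈y ∷ []) → from ∈widen (inj₂ ((s∈y , s-steep) , n-shifted)) }

  ⊆widen : ∀ {x} → x ⊆ widen x
  ⊆widen n∈x = from ∈widen (inj₁ n∈x)

  widen⊆ : ∀ {x} → (∀ {n} → n ∈ x → suc c * lev n ≤ pos n) → widen x ⊆ x
  widen⊆ x-cone n∈ with to ∈widen n∈
  ... | inj₁ n∈x = n∈x
  ... | inj₂ ((s∈x , s-steep) , _) = contradiction (x-cone s∈x) (<⇒≱ s-steep)

  shift∈widen : ∀ {x m} → Steep x m → shift m ∈ widen x
  shift∈widen {x} {m} m-steep = from ∈widen (inj₂
    ( subst (Steep x) (sym (source-shift m)) m-steep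
    , trans (pos-pair _ _) (cong (λ k → 2 + pos k) (sym (source-shift m)))))

  widen-tame⇒cone : ∀ {x} → Tame c (widen x) → ∀ {n} → n ∈ x → suc c * lev n ≤ pos n
  widen-tame⇒cone t {m} m∈x with suc c * lev m ≤? pos m
  ... | yes le = le
  ... | no ≰ = contradiction (subst (_≤ suc (pos m)) (pos-pair _ _) shift-near) 1+n≰n
    where
    shift-near : pos (shift m) ≤ suc (pos m)
    shift-near = narrow t (⊆widen m∈x) (shift∈widen (m∈x , ≰⇒> ≰))

  widen-tame : ∀ {x} → Tame (suc c) x → Tame c (widen x)
  widen-tame {x} t =
    Tame-⊆ (widen⊆ (cone t)) (Tame-cone shallow t) {h = half t} (⊆widen (bottom∈ t)) (lev-bottom t) (bottom-least t)
    where
    shallow : ∀ {n} → n ∈ x → c * lev n ≤ pos n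
    shallow {n} n∈x = ≤-trans (*-monoˡ-≤ (lev n) (n≤1+n c)) (cone t n∈x)

  widen-tame⁻¹ : ∀ {x} → Tame c (widen x) → Tame (suc c) x
  widen-tame⁻¹ {x} t =
    Tame-cone x-cone (Tame-⊆ ⊆widen t {h = half t} (widen⊆ x-cone (bottom∈ t)) (lev-bottom t) (bottom-least t))
    where
    x-cone : ∀ {n} → n ∈ x → suc c * lev n ≤ pos n
    x-cone = widen-tame⇒cone t

  𝒜-suc≤w𝒜 : 𝒜 (suc c) ≤w 𝒜 c
  𝒜-suc≤w𝒜 = widen , finitary⇒continuous widen-finitary ,
    λ _ → mk⇔ (Tame⇒𝒜 ∘ widen-tame ∘ 𝒜⇒Tame) (Tame⇒𝒜 ∘ widen-tame⁻¹ ∘ 𝒜⇒Tame)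

-- 𝒜 c does not reduce to 𝒜 (suc c)

module NoReduction (c : ℕ) (f : Pω → Pω) (f-cont : Continuous f)
                   (f-reduces : ∀ x → 𝒜 c x ⇔ 𝒜 (suc c) (f x)) where

  monotone : ∀ {x y} → x ⊆ y → f x ⊆ f y
  monotone = continuous⇒monotone f-cont

  tame-image : ∀ {x} → Tame c x → Tame (suc c) (f x)
  tame-image {x} = 𝒜⇒Tame ∘ to (f-reduces x) ∘ Tame⇒𝒜

  tame-preimage : ∀ {x} → Tame (suc c) (f x) → Tame c x
  tame-preimage {x} = 𝒜⇒Tame ∘ from (f-reduces x) ∘ Tame⇒𝒜

  floor-step : ∀ {t i} → c * (suc i + suc i) ≤ t
             → (∀ {n} → n ∈ f (column c t (i + i)) → i + i ≤ lev n)
             → ∀ {n} → n ∈ f (column c t (suc i + suc i)) → suc i + suc i ≤ lev n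
  floor-step {t} {i} le low-floor n∈ = ≤-trans top-raised (bottom-least top n∈)
    where
    odd≤even : suc (i + i) ≤ suc i + suc i
    odd≤even = s≤s (+-monoʳ-≤ i (n≤1+n i))
    top : Tame (suc c) (f (column c t (suc i + suc i)))
    top = tame-image (column-tame c t (suc i) le)
    top∈middle : bottom top ∈ f (column c t (suc (i + i)))
    top∈middle = monotone (column-antitone odd≤even) (bottom∈ top)
    middle⊆low : f (column c t (suc (i + i))) ⊆ f (column c t (i + i))
    middle⊆low = monotone (column-antitone (n≤1+n (i + i)))
    low : Tame (suc c) (f (column c t (i + i)))
    low = tame-image (column-tame c t i (≤-trans (*-monoʳ-≤ c (≤-trans (n≤1+n _) odd≤even)) le))
    top-raised : suc i + suc i ≤ half top + half top
    top-raised with double-gap {i} {half top}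
                      (subst (i + i ≤_) (lev-bottom top) (low-floor (middle⊆low top∈middle)))
    ... | inj₂ raised = raised
    ... | inj₁ stuck =
      contradiction (tame-preimage middle) (odd-column-¬tame c t i (≤-trans (*-monoʳ-≤ c odd≤even) le))
      where
      middle : Tame (suc c) (f (column c t (suc (i + i))))
      middle = Tame-⊆ middle⊆low low {h = half top} top∈middle (lev-bottom top)
                      (λ {n} n∈low → subst (_≤ lev n) (sym stuck) (low-floor n∈low))

  floor : ∀ t i → c * (i + i) ≤ t → ∀ {n} → n ∈ f (column c t (i + i)) → i + i ≤ lev n
  floor t zero    _  _ = z≤n
  floor t (suc i) le   = floor-step le (floor t i (≤-trans (*-monoʳ-≤ c i+i≤) le))
    where
    i+i≤ : i + i ≤ suc i + suc i
    i+i≤ = +-mono-≤ (n≤1+n i) (n≤1+n i)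

  base : ∀ t → Tame (suc c) (f (column c t 0))
  base t = tame-image (column-tame c t 0 (m*0≤n c t))

  s₀ : ℕ
  s₀ = pos (bottom (base 0))

  reach : ∀ t {n} → n ∈ f (column c t 0) → pos n ≤ suc (t + s₀)
  reach zero    n∈ = narrow (base 0) (bottom∈ (base 0)) n∈
  reach (suc t) n∈ = ≤-trans (narrow pair-tame (into (inj₁ refl) (bottom∈ (base t))) (into (inj₂ refl) n∈))
                             (s≤s (reach t (bottom∈ (base t))))
    where
    pair-tame : Tame (suc c) (f (adjacent c t))
    pair-tame = tame-image (adjacent-tame c t)
    into : ∀ {s} → s ≡ t ⊎ s ≡ suc t → f (column c s 0) ⊆ f (adjacent c t)
    into s-adj = monotone (column⊆adjacent s-adj)

  absurd : ⊥
  absurd = <⇒≱ (m<m+n i z<s) (+-cancelˡ-≤ t (i + i) i squeezed)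
    where
    i t b : ℕ
    i = suc s₀
    t = c * (i + i)
    top : Tame (suc c) (f (column c t (i + i)))
    top = tame-image (column-tame c t i ≤-refl)
    b = bottom top
    squeezed : t + (i + i) ≤ t + i
    squeezed = begin
      t + (i + i)        ≡⟨ +-comm t (i + i) ⟩
      suc c * (i + i)    ≤⟨ *-monoʳ-≤ (suc c) (floor t i ≤-refl (bottom∈ top)) ⟩
      suc c * lev b      ≤⟨ cone top (bottom∈ top) ⟩
      pos b              ≤⟨ reach t (monotone (column-antitone z≤n) (bottom∈ top)) ⟩
      suc (t + s₀)       ≡⟨ +-suc t s₀ ⟨
      t + i              ∎
      where open ≤-Reasoning

𝒜-irreducible : ∀ c → ¬ (𝒜 c ≤w 𝒜 (suc c))
𝒜-irreducible c (f , f-cont , f-reduces) = NoReduction.absurd c f f-cont f-reduces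

theorem36 : Σ (ℕ → SubPω) λ A → (∀ n → InDωΣ01 (A n)) × (∀ n → A (suc n) <w A n)
theorem36 = 𝒜 , 𝒜∈DωΣ01 , λ c → 𝒜-suc≤w𝒜 c , 𝒜-irreducible c
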